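{- Let $a,b,c\in\mathbb{Z}_{\geq 0}$ and let $\theta_{a,b,c}\in\operatorname{Der}_S$, $S=\mathbb{C}[x_1,x_2]$, be the vector field \[ \theta_{a,b,c}=\left(\int_0^{x_1}t^c(t-x_1)^b(t-x_2)^a\,dt\right)\partial_1+\left(\int_0^{x_2}t^c(t-x_1)^b(t-x_2)^a\,dt\right)\partial_2 . \] Then $\theta_{a,b,c}$ is homogeneous of degree $a+b+c+1$, and $\theta_{a,b,c}\in D(\mathcal{A},m)$, where $(\mathcal{A},m)$ is the multiarrangement in $\mathbb{C}^2$ with defining polynomial $Q(\mathcal{A},m)=x_1^{b+c+1}x_2^{a+c+1}(x_1-x_2)^{a+b+1}$.
   Context: $\operatorname{Der}_S=\bigoplus_i S\partial_i$ with $\partial_i=\partial/\partial x_i$. A multiarrangement $(\mathcal{A},m)$ is a finite set of linear hyperplanes $H=\ker\alpha_H$ with multiplicities $m(H)\in\mathbb{Z}_{\geq0}$; its defining polynomial is $\prod_H\alpha_H^{m(H)}$, and $D(\mathcal{A},m)=\{\delta\in\operatorname{Der}_S\mid \delta\alpha_H\in(\alpha_H^{m(H)})\text{ for all }H\in\mathcal{A}\}$. A vector field $\sum_j f_j\partial_j$ is homogeneous of degree $e$ if all nonzero $f_j$ are homogeneous polynomials of degree $e$. -}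

module Defs where

open import Data.Nat using (ℕ; zero; suc; _+_; _≟_)
open import Data.Integer using (+_)
open import Data.Rational using (ℚ; 0ℚ; 1ℚ; _/_) renaming (_+_ to _+ℚ_; _*_ to _*ℚ_; -_ to -ℚ_)
open import Data.Product using (_×_; _,_; Σ; ∃)
open import Data.List using (List; []; _∷_; _++_; map; concatMap)
open import Relation.Nullary using (¬_; yes; no)
open import Relation.Nullary.Decidable using (_×-dec_)
open import Relation.Binary.PropositionalEquality using (_≡_)

-- Polynomials over ℚ, represented as (not necessarily normalised) finite
-- sums of monomials.  Equality of polynomials is equality of all
-- coefficients (computed by `coeff`).

-- Bivariate: a term (q , i , j) stands for q · x₁^i · x₂^j.
Poly2 : Set
Poly2 = List (ℚ × ℕ × ℕ)

-- Trivariate in (t , x₁ , x₂): (q , k , i , j) stands for q · t^k x₁^i x₂^j.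
Poly3 : Set
Poly3 = List (ℚ × ℕ × ℕ × ℕ)

coeff : Poly2 → ℕ → ℕ → ℚ
coeff [] i j = 0ℚ
coeff ((q , i' , j') ∷ p) i j with (i' ≟ i) ×-dec (j' ≟ j)
... | yes _ = q +ℚ coeff p i j
... | no  _ = coeff p i j

_≈P_ : Poly2 → Poly2 → Set
p ≈P r = ∀ i j → coeff p i j ≡ coeff r i j

infix 4 _≈P_

_+P_ : Poly2 → Poly2 → Poly2
p +P r = p ++ r

-P_ : Poly2 → Poly2
-P p = map (λ { (q , i , j) → (-ℚ q , i , j) }) p

_*P_ : Poly2 → Poly2 → Poly2
p *P r = concatMap (λ { (q , i , j) →
           map (λ { (q' , i' , j') → (q *ℚ q' , i + i' , j + j') }) r }) p

oneP : Poly2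
oneP = (1ℚ , 0 , 0) ∷ []

_^P_ : Poly2 → ℕ → Poly2
p ^P zero  = oneP
p ^P suc n = p *P (p ^P n)

x₁ x₂ : Poly2
x₁ = (1ℚ , 1 , 0) ∷ []
x₂ = (1ℚ , 0 , 1) ∷ []

_∣P_ : Poly2 → Poly2 → Set
f ∣P g = Σ Poly2 λ h → g ≈P (f *P h)

_*T_ : Poly3 → Poly3 → Poly3
p *T r = concatMap (λ { (q , k , i , j) →
           map (λ { (q' , k' , i' , j') → (q *ℚ q' , k + k' , i + i' , j + j') }) r }) p

_^T_ : Poly3 → ℕ → Poly3
p ^T zero  = (1ℚ , 0 , 0 , 0) ∷ []
p ^T suc n = p *T (p ^T n)

tT x₁T x₂T : Poly3
tT  = (1ℚ , 1 , 0 , 0) ∷ []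
x₁T = (1ℚ , 0 , 1 , 0) ∷ []
x₂T = (1ℚ , 0 , 0 , 1) ∷ []

-_T : Poly3 → Poly3
-_T p = map (λ { (q , k , i , j) → (-ℚ q , k , i , j) }) p

_-T_ : Poly3 → Poly3 → Poly3
p -T r = p ++ (-_T r)

-- ∫₀^{x₁} f(t,x₁,x₂) dt  and  ∫₀^{x₂} f(t,x₁,x₂) dt   (termwise:
-- ∫₀^{x} t^k dt = x^(k+1)/(k+1)).
∫₀^x₁ : Poly3 → Poly2
∫₀^x₁ p = map (λ { (q , k , i , j) → (q *ℚ (+ 1 / suc k) , i + suc k , j) }) p

∫₀^x₂ : Poly3 → Poly2
∫₀^x₂ p = map (λ { (q , k , i , j) → (q *ℚ (+ 1 / suc k) , i , j + suc k) }) p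

-- Vector fields on ℚ² : f₁ ∂₁ + f₂ ∂₂
VectorField : Set
VectorField = Poly2 × Poly2

HomogeneousPoly : ℕ → Poly2 → Set
HomogeneousPoly e f = ∀ i j → ¬ (coeff f i j ≡ 0ℚ) → i + j ≡ e

HomogeneousVF : ℕ → VectorField → Set
HomogeneousVF e (f₁ , f₂) = HomogeneousPoly e f₁ × HomogeneousPoly e f₂

LinForm : Set
LinForm = ℚ × ℚ

linPoly : LinForm → Poly2
linPoly (a₁ , a₂) = ((a₁ , 1 , 0) ∷ []) +P ((a₂ , 0 , 1) ∷ [])

applyVF : VectorField → LinForm → Poly2
applyVF (f₁ , f₂) (a₁ , a₂) = (((a₁ , 0 , 0) ∷ []) *P f₁) +P (((a₂ , 0 , 0) ∷ []) *P f₂)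

-- a multiarrangement: list of hyperplanes ker α_H with multiplicities
MultiArr : Set
MultiArr = List (LinForm × ℕ)

definingPoly : MultiArr → Poly2
definingPoly [] = oneP
definingPoly ((α , m) ∷ A) = (linPoly α ^P m) *P definingPoly A

data All' (P : LinForm × ℕ → Set) : MultiArr → Set where
  []  : All' P []
  _∷_ : ∀ {x xs} → P x → All' P xs → All' P (x ∷ xs)

_∈D_ : VectorField → MultiArr → Set
δ ∈D A = All' (λ { (α , m) → (linPoly α ^P m) ∣P applyVF δ α }) A

integrand : ℕ → ℕ → ℕ → Poly3
integrand a b c = ((tT ^T c) *T ((tT -T x₁T) ^T b)) *T ((tT -T x₂T) ^T a)

θ : ℕ → ℕ → ℕ → VectorField
θ a b c = (∫₀^x₁ (integrand a b c) , ∫₀^x₂ (integrand a b c))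

𝒜 : ℕ → ℕ → ℕ → MultiArr
𝒜 a b c = ((1ℚ , 0ℚ) , suc (b + c))
        ∷ ((0ℚ , 1ℚ) , suc (a + c))
        ∷ ((1ℚ , -ℚ 1ℚ) , suc (a + b))
        ∷ []

{-# OPTIONS --safe #-}
module Submission where

-- Every monomial t^k x₁^i x₂^j of the integrand t^c (t - x₁)^b (t - x₂)^a has k + i + j = a + b + c,
-- k + i ≥ b + c and k + j ≥ a + c, and ∫₀^{x₁} sends it to x₁^(i+k+1) x₂^j / (k+1) (similarly for x₂);
-- this gives homogeneity and divisibility by x₁^(b+c+1) and x₂^(a+c+1).
-- For x₁ - x₂ consider Δ = ∫₀^{x₁} - ∫₀^{x₂}, which is ℚ[x₁,x₂]-linear. Writing t - x₁ = (t - x₂) - (x₁ - x₂)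
-- and t = (t - x₂) + x₂ reduces Δ of the integrand, by induction on b and c, to Δ((t - x₂)^a), and the
-- fundamental theorem of calculus gives (a + 1) Δ((t - x₂)^a) = (x₁ - x₂)^(a+1) - 0^(a+1).

open import Defs
open import Level using (0ℓ)
open import Function using (_∘_)
open import Data.Bool using (if_then_else_)
open import Data.Nat using (ℕ; zero; suc; _+_; _∸_; _≤_; _<_; z≤n; s≤s)
import Data.Nat as ℕ
import Data.Nat.Properties as ℕ
open import Data.Nat.Tactic.RingSolver using () renaming (solve-∀ to ℕ-solve-∀)
open import Data.Integer using (+_)
import Data.Integer as ℤ
open import Data.Integer.Tactic.RingSolver using () renaming (solve-∀ to ℤ-solve-∀)
open import Data.Rational using (ℚ; 0ℚ; 1ℚ; _/_; toℚᵘ)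
  renaming (_+_ to _+ℚ_; _*_ to _*ℚ_; -_ to -ℚ_)
import Data.Rational.Properties as ℚ
open import Data.Rational.Solver using (module +-*-Solver)
open import Data.Rational.Unnormalised using (mkℚᵘ; *≡*) renaming (_≃_ to _≃ᵘ_)
import Data.Rational.Unnormalised.Properties as ℚᵘ
open import Data.Product using (_×_; _,_; proj₁; proj₂; zip′)
open import Data.List using (List; []; _∷_; _++_; map; concatMap)
import Data.List.Properties as List
open import Data.List.Relation.Unary.All as All using (All; []; _∷_)
import Data.List.Relation.Unary.All.Properties as All
import Data.Maybe as Maybe
open import Relation.Nullary using (¬_; yes; no; contradiction)
open import Relation.Nullary.Decidable using (dec⇒maybe; _×-dec_)
open import Relation.Binary using (IsEquivalence)
open import Relation.Binary.PropositionalEquality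
import Relation.Binary.Reasoning.Setoid as ≈-Reasoning
open import Algebra.Bundles using (CommutativeRing)
import Algebra.Structures as Structures
open import Algebra.Properties.CommutativeSemigroup ℕ.+-commutativeSemigroup
  using () renaming (interchange to +-interchange)
open import Algebra.Properties.Monoid.Mult ℚ.+-0-monoid using (×-homo-+) renaming (_×_ to _×ℚ_)
open import Algebra.Solver.Ring.AlmostCommutativeRing
  using (fromCommutativeRing; _-Raw-AlmostCommutative⟶_)
import Algebra.Solver.Ring as RingSolver

-- Finite ℚ-linear combinations of monomials

module _ {M : Set} where

  ⟦_⟧ : List (ℚ × M) → (M → ℚ) → ℚ
  ⟦ [] ⟧          F = 0ℚ
  ⟦ (q , m) ∷ p ⟧ F = q *ℚ F m +ℚ ⟦ p ⟧ F

  -- Equality of all pairings is coefficient equality (pair with the indicator of a monomial, see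
  -- coeff-⟦⟧), and it is a congruence for all the operations below without normalising term lists.
  infix 4 _≋_
  record _≋_ (p r : List (ℚ × M)) : Set where
    constructor mk≋
    field at : ∀ F → ⟦ p ⟧ F ≡ ⟦ r ⟧ F
  open _≋_ public

  ≋-isEquivalence : IsEquivalence _≋_
  ≋-isEquivalence = record
    { refl  = mk≋ λ F → refl
    ; sym   = λ p≋r → mk≋ λ F → sym (at p≋r F)
    ; trans = λ p≋r r≋s → mk≋ λ F → trans (at p≋r F) (at r≋s F)
    }

  ≋-reflexive : ∀ {p r} → p ≡ r → p ≋ r
  ≋-reflexive refl = mk≋ λ F → refl

  negate : List (ℚ × M) → List (ℚ × M)
  negate = map (λ (q , m) → (-ℚ q , m))

  convolve : (M → M → M) → List (ℚ × M) → List (ℚ × M) → List (ℚ × M)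
  convolve _∙_ p r = concatMap (λ (q , m) → map (λ (q′ , m′) → (q *ℚ q′ , m ∙ m′)) r) p

linearMap : {A B : Set} → (A → ℚ) → (A → B) → List (ℚ × A) → List (ℚ × B)
linearMap c φ = map (λ (q , m) → (q *ℚ c m , φ m))

module _ {M : Set} where
  open +-*-Solver using (solve; _:=_; _:+_; _:*_; :-_; con)

  ⟦⟧-++ : ∀ (p r : List (ℚ × M)) F → ⟦ p ++ r ⟧ F ≡ ⟦ p ⟧ F +ℚ ⟦ r ⟧ F
  ⟦⟧-++ []            r F = sym (ℚ.+-identityˡ _)
  ⟦⟧-++ ((q , m) ∷ p) r F rewrite ⟦⟧-++ p r F = sym (ℚ.+-assoc (q *ℚ F m) _ _)

  ⟦⟧-cong-All : ∀ (p : List (ℚ × M)) {F G : M → ℚ} → All (λ (_ , m) → F m ≡ G m) p → ⟦ p ⟧ F ≡ ⟦ p ⟧ G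
  ⟦⟧-cong-All []            []       = refl
  ⟦⟧-cong-All ((q , m) ∷ p) (e ∷ es) = cong₂ (λ x y → q *ℚ x +ℚ y) e (⟦⟧-cong-All p es)

  ⟦⟧-congʳ : ∀ (p : List (ℚ × M)) {F G} → F ≗ G → ⟦ p ⟧ F ≡ ⟦ p ⟧ G
  ⟦⟧-congʳ p F≗G = ⟦⟧-cong-All p (All.universal (λ (_ , m) → F≗G m) p)

  ⟦⟧-linear-+ : ∀ (p : List (ℚ × M)) F G → ⟦ p ⟧ (λ m → F m +ℚ G m) ≡ ⟦ p ⟧ F +ℚ ⟦ p ⟧ G
  ⟦⟧-linear-+ []            F G = refl
  ⟦⟧-linear-+ ((q , m) ∷ p) F G rewrite ⟦⟧-linear-+ p F G =
    solve 5 (λ q a b c d → q :* (a :+ b) :+ (c :+ d) := (q :* a :+ c) :+ (q :* b :+ d))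
      refl q (F m) (G m) (⟦ p ⟧ F) (⟦ p ⟧ G)

  ⟦⟧-linear-* : ∀ (p : List (ℚ × M)) c F → ⟦ p ⟧ (λ m → c *ℚ F m) ≡ c *ℚ ⟦ p ⟧ F
  ⟦⟧-linear-* []            c F = sym (ℚ.*-zeroʳ c)
  ⟦⟧-linear-* ((q , m) ∷ p) c F rewrite ⟦⟧-linear-* p c F =
    solve 4 (λ q c a d → q :* (c :* a) :+ c :* d := c :* (q :* a :+ d)) refl q c (F m) (⟦ p ⟧ F)

  ⟦⟧-zero : ∀ (p : List (ℚ × M)) → ⟦ p ⟧ (λ _ → 0ℚ) ≡ 0ℚ
  ⟦⟧-zero []            = refl
  ⟦⟧-zero ((q , m) ∷ p) rewrite ⟦⟧-zero p = solve 1 (λ q → q :* con 0ℚ :+ con 0ℚ := con 0ℚ) refl q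

  ⟦⟧-negate : ∀ (p : List (ℚ × M)) F → ⟦ negate p ⟧ F ≡ -ℚ ⟦ p ⟧ F
  ⟦⟧-negate []            F = refl
  ⟦⟧-negate ((q , m) ∷ p) F rewrite ⟦⟧-negate p F =
    solve 3 (λ q a d → (:- q) :* a :+ (:- d) := :- (q :* a :+ d)) refl q (F m) (⟦ p ⟧ F)

  ⟦⟧-convolve : ∀ (_∙_ : M → M → M) p r F →
                ⟦ convolve _∙_ p r ⟧ F ≡ ⟦ p ⟧ (λ a → ⟦ r ⟧ (λ b → F (a ∙ b)))
  ⟦⟧-convolve _∙_ []            r F = refl
  ⟦⟧-convolve _∙_ ((q , m) ∷ p) r F =
    trans (⟦⟧-++ (map _ r) (convolve _∙_ p r) F) (cong₂ _+ℚ_ (row r) (⟦⟧-convolve _∙_ p r F))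
    where
    row : ∀ r → ⟦ map (λ (q′ , m′) → (q *ℚ q′ , m ∙ m′)) r ⟧ F ≡ q *ℚ ⟦ r ⟧ (λ b → F (m ∙ b))
    row []              = sym (ℚ.*-zeroʳ q)
    row ((q′ , m′) ∷ r) rewrite row r =
      solve 4 (λ q q′ a d → q :* q′ :* a :+ q :* d := q :* (q′ :* a :+ d))
        refl q q′ (F (m ∙ m′)) (⟦ r ⟧ (λ b → F (m ∙ b)))

⟦⟧-linearMap : ∀ {A B : Set} (c : A → ℚ) (φ : A → B) p F →
               ⟦ linearMap c φ p ⟧ F ≡ ⟦ p ⟧ (λ m → c m *ℚ F (φ m))
⟦⟧-linearMap c φ []            F = refl
⟦⟧-linearMap c φ ((q , m) ∷ p) F =
  cong₂ _+ℚ_ (ℚ.*-assoc q (c m) (F (φ m))) (⟦⟧-linearMap c φ p F)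

⟦⟧-swap : ∀ {A B : Set} (p : List (ℚ × A)) (r : List (ℚ × B)) (G : A → B → ℚ) →
          ⟦ p ⟧ (λ a → ⟦ r ⟧ (G a)) ≡ ⟦ r ⟧ (λ b → ⟦ p ⟧ (λ a → G a b))
⟦⟧-swap []            r G = sym (⟦⟧-zero r)
⟦⟧-swap ((q , m) ∷ p) r G = begin
  q *ℚ ⟦ r ⟧ (G m) +ℚ ⟦ p ⟧ (λ a → ⟦ r ⟧ (G a))
    ≡⟨ cong₂ _+ℚ_ (sym (⟦⟧-linear-* r q (G m))) (⟦⟧-swap p r G) ⟩
  ⟦ r ⟧ (λ b → q *ℚ G m b) +ℚ ⟦ r ⟧ (λ b → ⟦ p ⟧ (λ a → G a b))
    ≡⟨ sym (⟦⟧-linear-+ r (λ b → q *ℚ G m b) (λ b → ⟦ p ⟧ (λ a → G a b))) ⟩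
  ⟦ r ⟧ (λ b → q *ℚ G m b +ℚ ⟦ p ⟧ (λ a → G a b)) ∎
  where open ≡-Reasoning

module _ {A B : Set} (c : A → ℚ) (φ : A → B) where

  linearMap-cong : ∀ {p r} → p ≋ r → linearMap c φ p ≋ linearMap c φ r
  linearMap-cong {p} {r} p≋r = mk≋ λ F →
    trans (⟦⟧-linearMap c φ p F) (trans (at p≋r _) (sym (⟦⟧-linearMap c φ r F)))

  linearMap-++ : ∀ p r → linearMap c φ (p ++ r) ≡ linearMap c φ p ++ linearMap c φ r
  linearMap-++ = List.map-++ _

  linearMap-negate : ∀ p → linearMap c φ (negate p) ≋ negate (linearMap c φ p)
  linearMap-negate p = mk≋ λ F → begin
    ⟦ linearMap c φ (negate p) ⟧ F          ≡⟨ ⟦⟧-linearMap c φ (negate p) F ⟩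
    ⟦ negate p ⟧ (λ m → c m *ℚ F (φ m))     ≡⟨ ⟦⟧-negate p _ ⟩
    -ℚ ⟦ p ⟧ (λ m → c m *ℚ F (φ m))         ≡⟨ cong -ℚ_ (⟦⟧-linearMap c φ p F) ⟨
    -ℚ ⟦ linearMap c φ p ⟧ F                ≡⟨ ⟦⟧-negate (linearMap c φ p) F ⟨
    ⟦ negate (linearMap c φ p) ⟧ F          ∎
    where open ≡-Reasoning

module _ {A B : Set} {_∙_ : A → A → A} {_◦_ : B → B → B} where

  linearMap-convolve : ∀ (φ : A → B) → (∀ a a′ → φ (a ∙ a′) ≡ φ a ◦ φ a′) → ∀ p r →
    linearMap (λ _ → 1ℚ) φ (convolve _∙_ p r) ≋
    convolve _◦_ (linearMap (λ _ → 1ℚ) φ p) (linearMap (λ _ → 1ℚ) φ r)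
  linearMap-convolve φ φ-homo p r = mk≋ λ F → begin
    ⟦ f (convolve _∙_ p r) ⟧ F                           ≡⟨ ⟦⟧-linearMap _ φ (convolve _∙_ p r) F ⟩
    ⟦ convolve _∙_ p r ⟧ (λ m → 1ℚ *ℚ F (φ m))           ≡⟨ ⟦⟧-convolve _∙_ p r _ ⟩
    ⟦ p ⟧ (λ a → ⟦ r ⟧ (λ a′ → 1ℚ *ℚ F (φ (a ∙ a′))))
      ≡⟨ ⟦⟧-congʳ p (λ a → ⟦⟧-congʳ r (λ a′ → cong (λ m → 1ℚ *ℚ F m) (φ-homo a a′))) ⟩
    ⟦ p ⟧ (λ a → ⟦ r ⟧ (λ a′ → 1ℚ *ℚ F (φ a ◦ φ a′)))
      ≡⟨ ⟦⟧-congʳ p (λ a → trans (ℚ.*-identityˡ _) (⟦⟧-linearMap _ φ r _)) ⟨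
    ⟦ p ⟧ (λ a → 1ℚ *ℚ ⟦ f r ⟧ (λ b → F (φ a ◦ b)))     ≡⟨ ⟦⟧-linearMap _ φ p _ ⟨
    ⟦ f p ⟧ (λ b → ⟦ f r ⟧ (λ b′ → F (b ◦ b′)))          ≡⟨ ⟦⟧-convolve _◦_ (f p) (f r) F ⟨
    ⟦ convolve _◦_ (f p) (f r) ⟧ F                       ∎
    where
    open ≡-Reasoning
    f = linearMap (λ _ → 1ℚ) φ

  linearMap-convolveˡ : ∀ (c : A → ℚ) (φ : A → B) (ι : B → A) →
    (∀ b a → c (ι b ∙ a) ≡ c a) → (∀ b a → φ (ι b ∙ a) ≡ b ◦ φ a) → ∀ s p →
    linearMap c φ (convolve _∙_ (linearMap (λ _ → 1ℚ) ι s) p) ≋ convolve _◦_ s (linearMap c φ p)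
  linearMap-convolveˡ c φ ι c-ι φ-ι s p = mk≋ λ F → begin
    ⟦ linearMap c φ (convolve _∙_ (linearMap _ ι s) p) ⟧ F
      ≡⟨ ⟦⟧-linearMap c φ (convolve _∙_ (linearMap _ ι s) p) F ⟩
    ⟦ convolve _∙_ (linearMap _ ι s) p ⟧ (λ m → c m *ℚ F (φ m))
      ≡⟨ ⟦⟧-convolve _∙_ (linearMap _ ι s) p _ ⟩
    ⟦ linearMap _ ι s ⟧ (λ a → ⟦ p ⟧ (λ a′ → c (a ∙ a′) *ℚ F (φ (a ∙ a′))))
      ≡⟨ ⟦⟧-linearMap _ ι s _ ⟩
    ⟦ s ⟧ (λ b → 1ℚ *ℚ ⟦ p ⟧ (λ a → c (ι b ∙ a) *ℚ F (φ (ι b ∙ a))))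
      ≡⟨ ⟦⟧-congʳ s (λ b → trans (ℚ.*-identityˡ _)
           (⟦⟧-congʳ p (λ a → cong₂ (λ x m → x *ℚ F m) (c-ι b a) (φ-ι b a)))) ⟩
    ⟦ s ⟧ (λ b → ⟦ p ⟧ (λ a → c a *ℚ F (b ◦ φ a)))
      ≡⟨ ⟦⟧-congʳ s (λ b → ⟦⟧-linearMap c φ p _) ⟨
    ⟦ s ⟧ (λ b → ⟦ linearMap c φ p ⟧ (λ b′ → F (b ◦ b′)))
      ≡⟨ ⟦⟧-convolve _◦_ s (linearMap c φ p) F ⟨
    ⟦ convolve _◦_ s (linearMap c φ p) ⟧ F ∎
    where open ≡-Reasoning

module _ {M : Set} {_∙_ : M → M → M} {P Q R : M → Set} where

  All-convolve : ∀ {p r} → (∀ {a b} → P a → Q b → R (a ∙ b)) →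
                 All (P ∘ proj₂) p → All (Q ∘ proj₂) r → All (R ∘ proj₂) (convolve _∙_ p r)
  All-convolve PQ⇒R []         Qr = []
  All-convolve PQ⇒R (Pa ∷ Pp) Qr = All.++⁺ (All.map⁺ (All.map (PQ⇒R Pa) Qr)) (All-convolve PQ⇒R Pp Qr)

All-linearMap : ∀ {A B : Set} {P : A → Set} {Q : B → Set} {c : A → ℚ} {φ : A → B} {p} →
                (∀ {a} → P a → Q (φ a)) → All (P ∘ proj₂) p → All (Q ∘ proj₂) (linearMap c φ p)
All-linearMap P⇒Qφ = All.map⁺ ∘ All.map P⇒Qφ

module MonoidAlgebra {M : Set} {_∙_ : M → M → M} {ε : M}
                     (isCommutativeMonoid : Structures.IsCommutativeMonoid _≡_ _∙_ ε) where
  open Structures.IsCommutativeMonoid isCommutativeMonoid using (assoc; comm; identityˡ)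
  open +-*-Solver using (solve; _:=_; _:+_; _:*_; con)

  Poly : Set
  Poly = List (ℚ × M)

  constant : ℚ → Poly
  constant q = (q , ε) ∷ []

  _⊗_ : Poly → Poly → Poly
  _⊗_ = convolve _∙_

  ⟦⟧-⊗ : ∀ p r F → ⟦ p ⊗ r ⟧ F ≡ ⟦ p ⟧ (λ a → ⟦ r ⟧ (λ b → F (a ∙ b)))
  ⟦⟧-⊗ = ⟦⟧-convolve _∙_

  private
    ⊗-cong : ∀ {p p′ r r′} → p ≋ p′ → r ≋ r′ → p ⊗ r ≋ p′ ⊗ r′
    ⊗-cong {p} {p′} {r} {r′} p≋p′ r≋r′ = mk≋ λ F → begin
      ⟦ p ⊗ r ⟧ F                                ≡⟨ ⟦⟧-⊗ p r F ⟩
      ⟦ p ⟧ (λ a → ⟦ r ⟧ (λ b → F (a ∙ b)))     ≡⟨ at p≋p′ _ ⟩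
      ⟦ p′ ⟧ (λ a → ⟦ r ⟧ (λ b → F (a ∙ b)))    ≡⟨ ⟦⟧-congʳ p′ (λ a → at r≋r′ _) ⟩
      ⟦ p′ ⟧ (λ a → ⟦ r′ ⟧ (λ b → F (a ∙ b)))   ≡⟨ ⟦⟧-⊗ p′ r′ F ⟨
      ⟦ p′ ⊗ r′ ⟧ F                              ∎
      where open ≡-Reasoning

    ⊗-assoc : ∀ p r s → (p ⊗ r) ⊗ s ≋ p ⊗ (r ⊗ s)
    ⊗-assoc p r s = mk≋ λ F → begin
      ⟦ (p ⊗ r) ⊗ s ⟧ F                                              ≡⟨ ⟦⟧-⊗ (p ⊗ r) s F ⟩
      ⟦ p ⊗ r ⟧ (λ w → ⟦ s ⟧ (λ c → F (w ∙ c)))                       ≡⟨ ⟦⟧-⊗ p r _ ⟩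
      ⟦ p ⟧ (λ a → ⟦ r ⟧ (λ b → ⟦ s ⟧ (λ c → F ((a ∙ b) ∙ c))))
        ≡⟨ ⟦⟧-congʳ p (λ a → ⟦⟧-congʳ r (λ b → ⟦⟧-congʳ s (λ c → cong F (assoc a b c)))) ⟩
      ⟦ p ⟧ (λ a → ⟦ r ⟧ (λ b → ⟦ s ⟧ (λ c → F (a ∙ (b ∙ c)))))       ≡⟨ ⟦⟧-congʳ p (λ a → ⟦⟧-⊗ r s _) ⟨
      ⟦ p ⟧ (λ a → ⟦ r ⊗ s ⟧ (λ v → F (a ∙ v)))                       ≡⟨ ⟦⟧-⊗ p (r ⊗ s) F ⟨
      ⟦ p ⊗ (r ⊗ s) ⟧ F                                              ∎
      where open ≡-Reasoning

    ⊗-comm : ∀ p r → p ⊗ r ≋ r ⊗ p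
    ⊗-comm p r = mk≋ λ F → begin
      ⟦ p ⊗ r ⟧ F                               ≡⟨ ⟦⟧-⊗ p r F ⟩
      ⟦ p ⟧ (λ a → ⟦ r ⟧ (λ b → F (a ∙ b)))    ≡⟨ ⟦⟧-swap p r (λ a b → F (a ∙ b)) ⟩
      ⟦ r ⟧ (λ b → ⟦ p ⟧ (λ a → F (a ∙ b)))    ≡⟨ ⟦⟧-congʳ r (λ b → ⟦⟧-congʳ p (λ a → cong F (comm a b))) ⟩
      ⟦ r ⟧ (λ b → ⟦ p ⟧ (λ a → F (b ∙ a)))    ≡⟨ ⟦⟧-⊗ r p F ⟨
      ⟦ r ⊗ p ⟧ F                               ∎
      where open ≡-Reasoning

    ⊗-identityˡ : ∀ p → constant 1ℚ ⊗ p ≋ p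
    ⊗-identityˡ p = mk≋ λ F → begin
      ⟦ constant 1ℚ ⊗ p ⟧ F                 ≡⟨ ⟦⟧-⊗ (constant 1ℚ) p F ⟩
      1ℚ *ℚ ⟦ p ⟧ (λ b → F (ε ∙ b)) +ℚ 0ℚ   ≡⟨ solve 1 (λ x → con 1ℚ :* x :+ con 0ℚ := x) refl _ ⟩
      ⟦ p ⟧ (λ b → F (ε ∙ b))               ≡⟨ ⟦⟧-congʳ p (λ b → cong F (identityˡ b)) ⟩
      ⟦ p ⟧ F                               ∎
      where open ≡-Reasoning

    ⊗-distribʳ : ∀ s p r → (p ++ r) ⊗ s ≋ p ⊗ s ++ r ⊗ s
    ⊗-distribʳ s p r = mk≋ λ F → let G = λ a → ⟦ s ⟧ (λ b → F (a ∙ b)) in begin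
      ⟦ (p ++ r) ⊗ s ⟧ F          ≡⟨ ⟦⟧-⊗ (p ++ r) s F ⟩
      ⟦ p ++ r ⟧ G                ≡⟨ ⟦⟧-++ p r G ⟩
      ⟦ p ⟧ G +ℚ ⟦ r ⟧ G          ≡⟨ cong₂ _+ℚ_ (⟦⟧-⊗ p s F) (⟦⟧-⊗ r s F) ⟨
      ⟦ p ⊗ s ⟧ F +ℚ ⟦ r ⊗ s ⟧ F  ≡⟨ ⟦⟧-++ (p ⊗ s) (r ⊗ s) F ⟨
      ⟦ p ⊗ s ++ r ⊗ s ⟧ F        ∎
      where open ≡-Reasoning

    ++-cong : ∀ {p p′ r r′ : Poly} → p ≋ p′ → r ≋ r′ → p ++ r ≋ p′ ++ r′
    ++-cong {p} {p′} {r} {r′} p≋p′ r≋r′ = mk≋ λ F →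
      trans (⟦⟧-++ p r F) (trans (cong₂ _+ℚ_ (at p≋p′ F) (at r≋r′ F)) (sym (⟦⟧-++ p′ r′ F)))

    ++-comm : ∀ (p r : Poly) → p ++ r ≋ r ++ p
    ++-comm p r = mk≋ λ F → trans (⟦⟧-++ p r F) (trans (ℚ.+-comm (⟦ p ⟧ F) (⟦ r ⟧ F)) (sym (⟦⟧-++ r p F)))

    negate-cong : ∀ {p p′ : Poly} → p ≋ p′ → negate p ≋ negate p′
    negate-cong {p} {p′} p≋p′ = mk≋ λ F →
      trans (⟦⟧-negate p F) (trans (cong -ℚ_ (at p≋p′ F)) (sym (⟦⟧-negate p′ F)))

    negate-inverseˡ : ∀ (p : Poly) → negate p ++ p ≋ []
    negate-inverseˡ p = mk≋ λ F → trans (⟦⟧-++ (negate p) p F)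
      (trans (cong (_+ℚ ⟦ p ⟧ F) (⟦⟧-negate p F)) (ℚ.+-inverseˡ (⟦ p ⟧ F)))

    open IsEquivalence (≋-isEquivalence {M = M}) using () renaming (trans to ≋-trans)

  ring : CommutativeRing 0ℓ 0ℓ
  ring = record
    { Carrier = Poly ; _≈_ = _≋_ ; _+_ = _++_ ; _*_ = _⊗_ ; -_ = negate ; 0# = [] ; 1# = constant 1ℚ
    ; isCommutativeRing = record
      { isRing = record
        { +-isAbelianGroup = record
          { isGroup = record
            { isMonoid = record
              { isSemigroup = record
                { isMagma = record { isEquivalence = ≋-isEquivalence ; ∙-cong = ++-cong }
                ; assoc = λ p r s → ≋-reflexive (List.++-assoc p r s) }
              ; identity = (λ p → ≋-reflexive refl) , (λ p → ≋-reflexive (List.++-identityʳ p)) }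
            ; inverse = negate-inverseˡ , (λ p → ≋-trans (++-comm p (negate p)) (negate-inverseˡ p))
            ; ⁻¹-cong = negate-cong }
          ; comm = ++-comm }
        ; *-cong = ⊗-cong
        ; *-assoc = ⊗-assoc
        ; *-identity = ⊗-identityˡ , (λ p → ≋-trans (⊗-comm p (constant 1ℚ)) (⊗-identityˡ p))
        ; distrib = (λ s p r → ≋-trans (⊗-comm s (p ++ r))
                      (≋-trans (⊗-distribʳ s p r) (++-cong (⊗-comm p s) (⊗-comm r s))))
                  , ⊗-distribʳ }
      ; *-comm = ⊗-comm } }

  constant-+ : ∀ q q′ → constant (q +ℚ q′) ≋ constant q ++ constant q′
  constant-+ q q′ = mk≋ λ F →
    solve 3 (λ q q′ f → (q :+ q′) :* f :+ con 0ℚ := q :* f :+ (q′ :* f :+ con 0ℚ)) refl q q′ (F ε)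

  constant-* : ∀ q q′ → constant (q *ℚ q′) ≋ constant q ⊗ constant q′
  constant-* q q′ = mk≋ λ F → cong (λ m → (q *ℚ q′) *ℚ F m +ℚ 0ℚ) (sym (identityˡ ε))

  constant-homo : CommutativeRing.rawRing ℚ.+-*-commutativeRing -Raw-AlmostCommutative⟶ fromCommutativeRing ring
  constant-homo = record
    { ⟦_⟧ = constant ; +-homo = constant-+ ; *-homo = constant-* ; -‿homo = λ _ → ≋-reflexive refl
    ; 0-homo = mk≋ λ F → solve 1 (λ f → con 0ℚ :* f :+ con 0ℚ := con 0ℚ) refl (F ε)
    ; 1-homo = ≋-reflexive refl }

  monomial : M → Poly
  monomial u = (1ℚ , u) ∷ []

  factor-monomial : ∀ u (d : M → M) p → All (λ (_ , m) → u ∙ d m ≡ m) p →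
                    p ≋ monomial u ⊗ linearMap (λ _ → 1ℚ) d p
  factor-monomial u d p u∙d≡id = mk≋ λ F → sym (begin
    ⟦ monomial u ⊗ linearMap _ d p ⟧ F                    ≡⟨ ⟦⟧-⊗ (monomial u) (linearMap _ d p) F ⟩
    1ℚ *ℚ ⟦ linearMap _ d p ⟧ (λ b → F (u ∙ b)) +ℚ 0ℚ    ≡⟨ solve 1 (λ x → con 1ℚ :* x :+ con 0ℚ := x) refl _ ⟩
    ⟦ linearMap _ d p ⟧ (λ b → F (u ∙ b))                 ≡⟨ ⟦⟧-linearMap _ d p _ ⟩
    ⟦ p ⟧ (λ m → 1ℚ *ℚ F (u ∙ d m))
      ≡⟨ ⟦⟧-cong-All p (All.map (λ e → trans (ℚ.*-identityˡ _) (cong F e)) u∙d≡id) ⟩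
    ⟦ p ⟧ F                                              ∎)
    where open ≡-Reasoning

  module Solver = RingSolver (CommutativeRing.rawRing ℚ.+-*-commutativeRing) (fromCommutativeRing ring)
    constant-homo
    (λ q q′ → Maybe.map (≋-reflexive ∘ cong constant) (dec⇒maybe (q ℚ.≟ q′)))

module _ {c ℓ} (R : CommutativeRing c ℓ) where
  open CommutativeRing R using (-_; +-cong; -‿cong; distribʳ; *-rawMagma; ring)
    renaming (_+_ to _+ᴿ_; _-_ to _-ᴿ_; trans to ≈-trans; sym to ≈-sym)
  open import Algebra.Definitions.RawMagma *-rawMagma using (_∣_; _,_)
  open import Algebra.Properties.Ring ring using (-‿distribˡ-*)

  x∣y∧x∣z⇒x∣y+z : ∀ {x y z} → x ∣ y → x ∣ z → x ∣ y +ᴿ z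
  x∣y∧x∣z⇒x∣y+z {x} (q , qx≈y) (q′ , q′x≈z) = q +ᴿ q′ , ≈-trans (distribʳ x q q′) (+-cong qx≈y q′x≈z)

  x∣y∧x∣z⇒x∣y-z : ∀ {x y z} → x ∣ y → x ∣ z → x ∣ y -ᴿ z
  x∣y∧x∣z⇒x∣y-z {x} (q , qx≈y) (q′ , q′x≈z) =
    q -ᴿ q′ , ≈-trans (distribʳ x q (- q′)) (+-cong qx≈y (≈-trans (≈-sym (-‿distribˡ-* q′ x)) (-‿cong q′x≈z)))

module _ {A B : Set} {_∙_ : A → A → A} {_◦_ : B → B → B} {ε : A} {ε′ : B} where
  open Structures using (IsCommutativeMonoid)

  ×-isCommutativeMonoid : IsCommutativeMonoid _≡_ _∙_ ε → IsCommutativeMonoid _≡_ _◦_ ε′ →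
                          IsCommutativeMonoid _≡_ (zip′ _∙_ _◦_) (ε , ε′)
  ×-isCommutativeMonoid isCMᴬ isCMᴮ = record
    { isMonoid = record
      { isSemigroup = record
        { isMagma = record { isEquivalence = isEquivalence ; ∙-cong = cong₂ (zip′ _∙_ _◦_) }
        ; assoc = λ (a , b) (a′ , b′) (a″ , b″) → cong₂ _,_ (A.assoc a a′ a″) (B.assoc b b′ b″) }
      ; identity = (λ (a , b) → cong₂ _,_ (A.identityˡ a) (B.identityˡ b))
                 , (λ (a , b) → cong₂ _,_ (A.identityʳ a) (B.identityʳ b)) }
    ; comm = λ (a , b) (a′ , b′) → cong₂ _,_ (A.comm a a′) (B.comm b b′) }
    where
    module A = IsCommutativeMonoid isCMᴬ
    module B = IsCommutativeMonoid isCMᴮ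

Monomial₂ Monomial₃ : Set
Monomial₂ = ℕ × ℕ
Monomial₃ = ℕ × Monomial₂

_∙₂_ : Monomial₂ → Monomial₂ → Monomial₂
_∙₂_ = zip′ _+_ _+_

_∙₃_ : Monomial₃ → Monomial₃ → Monomial₃
_∙₃_ = zip′ _+_ _∙₂_

module P₂ = MonoidAlgebra (×-isCommutativeMonoid ℕ.+-0-isCommutativeMonoid ℕ.+-0-isCommutativeMonoid)
module P₃ = MonoidAlgebra (×-isCommutativeMonoid ℕ.+-0-isCommutativeMonoid
                            (×-isCommutativeMonoid ℕ.+-0-isCommutativeMonoid ℕ.+-0-isCommutativeMonoid))

module R₂ = CommutativeRing P₂.ring
module R₃ = CommutativeRing P₃.ring
open R₂ using () renaming (_-_ to _-P_)
open R₃ using () renaming (_+_ to _+T_)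
open import Algebra.Definitions.RawMagma R₂.*-rawMagma using (_∣_; _,_)
open import Algebra.Properties.CommutativeSemigroup.Divisibility R₂.*-commutativeSemigroup
  using (x∣ʳyx; ∣ʳ-trans; ∣ʳ-respʳ-≈; x∣ʳy⇒x∣ʳzy; x∣y⇒zx∣zy)

indicator : Monomial₂ → Monomial₂ → ℚ
indicator (i , j) (i′ , j′) with (i′ ℕ.≟ i) ×-dec (j′ ℕ.≟ j)
... | yes _ = 1ℚ
... | no  _ = 0ℚ

indicator-off : ∀ {i j} i′ j′ → ¬ (i′ ≡ i × j′ ≡ j) → indicator (i , j) (i′ , j′) ≡ 0ℚ
indicator-off {i} {j} i′ j′ ne with (i′ ℕ.≟ i) ×-dec (j′ ℕ.≟ j)
... | yes eq = contradiction eq ne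
... | no  _  = refl

coeff-⟦⟧ : ∀ p i j → coeff p i j ≡ ⟦ p ⟧ (indicator (i , j))
coeff-⟦⟧ []                  i j = refl
coeff-⟦⟧ ((q , i′ , j′) ∷ p) i j with (i′ ℕ.≟ i) ×-dec (j′ ℕ.≟ j)
... | yes _ = cong₂ _+ℚ_ (sym (ℚ.*-identityʳ q)) (coeff-⟦⟧ p i j)
... | no  _ = trans (coeff-⟦⟧ p i j) (sym (trans (cong (_+ℚ _) (ℚ.*-zeroʳ q)) (ℚ.+-identityˡ _)))

≋⇒≈P : ∀ {p r} → p ≋ r → p ≈P r
≋⇒≈P {p} {r} p≋r i j = trans (coeff-⟦⟧ p i j) (trans (at p≋r _) (sym (coeff-⟦⟧ r i j)))

All⇒HomogeneousPoly : ∀ e f → All (λ (_ , (i , j)) → i + j ≡ e) f → HomogeneousPoly e f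
All⇒HomogeneousPoly e f degrees i j coeff≢0 with i + j ℕ.≟ e
... | yes i+j≡e = i+j≡e
... | no  i+j≢e = contradiction (trans (coeff-⟦⟧ f i j) vanishes) coeff≢0
  where
  vanishes : ⟦ f ⟧ (indicator (i , j)) ≡ 0ℚ
  vanishes = trans (⟦⟧-cong-All f (All.map (λ {(_ , i′ , j′)} deg → indicator-off i′ j′ λ { (refl , refl) → i+j≢e deg })
                                           degrees))
                   (⟦⟧-zero f)

-- Calculus in t

fromℕ : ℕ → ℚ
fromℕ n = n ×ℚ 1ℚ

fromℕ-+ : ∀ m n → fromℕ (m + n) ≡ fromℕ m +ℚ fromℕ n
fromℕ-+ m n = ×-homo-+ 1ℚ m n

toℚᵘ-fromℕ : ∀ n → toℚᵘ (fromℕ n) ≃ᵘ mkℚᵘ (+ n) 0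
toℚᵘ-fromℕ zero    = ℚᵘ.≃-refl
toℚᵘ-fromℕ (suc n) = ℚᵘ.≃-trans (ℚ.toℚᵘ-homo-+ 1ℚ (fromℕ n))
  (ℚᵘ.≃-trans (ℚᵘ.+-congʳ (toℚᵘ 1ℚ) (toℚᵘ-fromℕ n)) (*≡* (ℤ-lemma (+ n))))
  where
  ℤ-lemma : ∀ z → ((+ 1 ℤ.* + 1) ℤ.+ (z ℤ.* + 1)) ℤ.* + 1 ≡ (+ 1 ℤ.+ z) ℤ.* (+ 1 ℤ.* + 1)
  ℤ-lemma = ℤ-solve-∀

fromℕ-suc-*-inverse : ∀ k → fromℕ (suc k) *ℚ (+ 1 / suc k) ≡ 1ℚ
fromℕ-suc-*-inverse k = ℚ.toℚᵘ-injective (ℚᵘ.≃-trans (ℚ.toℚᵘ-homo-* (fromℕ (suc k)) (+ 1 / suc k))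
  (ℚᵘ.≃-trans (ℚᵘ.*-cong (toℚᵘ-fromℕ (suc k)) (ℚ.toℚᵘ-fromℚᵘ (mkℚᵘ (+ 1) k)))
              (ℚᵘ.*-inverseʳ (mkℚᵘ (+ suc k) 0))))

ι : Poly2 → Poly3
ι = linearMap (λ _ → 1ℚ) (0 ,_)

ι-constant : ∀ q → ι (P₂.constant q) ≋ P₃.constant q
ι-constant q = mk≋ λ F → cong (λ x → x *ℚ F (0 , 0 , 0) +ℚ 0ℚ) (ℚ.*-identityʳ q)

t≔0 : Poly3 → Poly2
t≔0 = linearMap (λ (k , _) → if k ℕ.≡ᵇ 0 then 1ℚ else 0ℚ) proj₂

lowerₜ : Monomial₃ → Monomial₃
lowerₜ (k , m) = (k ∸ 1 , m)

-- At k = 0 the junk monomial lowerₜ (0 , m) = (0 , m) carries the coefficient fromℕ 0 = 0.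
∂ₜ : Poly3 → Poly3
∂ₜ = linearMap (fromℕ ∘ proj₁) lowerₜ

fromℕ-*-cong : ∀ k {x y} → (0 < k → x ≡ y) → fromℕ k *ℚ x ≡ fromℕ k *ℚ y
fromℕ-*-cong zero    {x} {y} _   = trans (ℚ.*-zeroˡ x) (sym (ℚ.*-zeroˡ y))
fromℕ-*-cong (suc k)         x≡y = cong (fromℕ (suc k) *ℚ_) (x≡y (s≤s z≤n))

∂ₜ-monomial : ∀ (F : Monomial₃ → ℚ) a b →
  fromℕ (proj₁ (a ∙₃ b)) *ℚ F (lowerₜ (a ∙₃ b)) ≡
  fromℕ (proj₁ a) *ℚ F (lowerₜ a ∙₃ b) +ℚ fromℕ (proj₁ b) *ℚ F (a ∙₃ lowerₜ b)
∂ₜ-monomial F (k , m) (k′ , m′) = begin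
  fromℕ (k + k′) *ℚ F X                  ≡⟨ cong (_*ℚ F X) (fromℕ-+ k k′) ⟩
  (fromℕ k +ℚ fromℕ k′) *ℚ F X           ≡⟨ ℚ.*-distribʳ-+ (F X) (fromℕ k) (fromℕ k′) ⟩
  fromℕ k *ℚ F X +ℚ fromℕ k′ *ℚ F X
    ≡⟨ cong₂ _+ℚ_ (fromℕ-*-cong k (λ 0<k → cong (λ i → F (i , m ∙₂ m′)) (ℕ.+-∸-comm k′ 0<k)))
                  (fromℕ-*-cong k′ (λ 0<k′ → cong (λ i → F (i , m ∙₂ m′)) (ℕ.+-∸-assoc k 0<k′))) ⟩
  fromℕ k *ℚ F (lowerₜ (k , m) ∙₃ (k′ , m′)) +ℚ fromℕ k′ *ℚ F ((k , m) ∙₃ lowerₜ (k′ , m′)) ∎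
  where
  open ≡-Reasoning
  X = lowerₜ ((k , m) ∙₃ (k′ , m′))

∂ₜ-leibniz : ∀ p r → ∂ₜ (p *T r) ≋ ∂ₜ p *T r ++ p *T ∂ₜ r
∂ₜ-leibniz p r = mk≋ λ F → begin
  ⟦ ∂ₜ (p *T r) ⟧ F
    ≡⟨ ⟦⟧-linearMap _ lowerₜ (p *T r) F ⟩
  ⟦ p *T r ⟧ (λ c → fromℕ (proj₁ c) *ℚ F (lowerₜ c))
    ≡⟨ P₃.⟦⟧-⊗ p r _ ⟩
  ⟦ p ⟧ (λ a → ⟦ r ⟧ (λ b → fromℕ (proj₁ (a ∙₃ b)) *ℚ F (lowerₜ (a ∙₃ b))))
    ≡⟨ ⟦⟧-congʳ p (λ a → trans (⟦⟧-congʳ r (∂ₜ-monomial F a)) (⟦⟧-linear-+ r _ _)) ⟩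
  ⟦ p ⟧ (λ a → ⟦ r ⟧ (λ b → fromℕ (proj₁ a) *ℚ F (lowerₜ a ∙₃ b))
             +ℚ ⟦ r ⟧ (λ b → fromℕ (proj₁ b) *ℚ F (a ∙₃ lowerₜ b)))
    ≡⟨ ⟦⟧-linear-+ p _ _ ⟩
  ⟦ p ⟧ (λ a → ⟦ r ⟧ (λ b → fromℕ (proj₁ a) *ℚ F (lowerₜ a ∙₃ b)))
    +ℚ ⟦ p ⟧ (λ a → ⟦ r ⟧ (λ b → fromℕ (proj₁ b) *ℚ F (a ∙₃ lowerₜ b)))
    ≡⟨ cong₂ _+ℚ_ (⟦⟧-congʳ p (λ a → ⟦⟧-linear-* r (fromℕ (proj₁ a)) _))
                  (⟦⟧-congʳ p (λ a → sym (⟦⟧-linearMap _ lowerₜ r _))) ⟩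
  ⟦ p ⟧ (λ a → fromℕ (proj₁ a) *ℚ ⟦ r ⟧ (λ b → F (lowerₜ a ∙₃ b)))
    +ℚ ⟦ p ⟧ (λ a → ⟦ ∂ₜ r ⟧ (λ b → F (a ∙₃ b)))
    ≡⟨ cong₂ _+ℚ_ (sym (⟦⟧-linearMap _ lowerₜ p _)) (sym (P₃.⟦⟧-⊗ p (∂ₜ r) F)) ⟩
  ⟦ ∂ₜ p ⟧ (λ a → ⟦ r ⟧ (λ b → F (a ∙₃ b))) +ℚ ⟦ p *T ∂ₜ r ⟧ F
    ≡⟨ cong (_+ℚ ⟦ p *T ∂ₜ r ⟧ F) (sym (P₃.⟦⟧-⊗ (∂ₜ p) r F)) ⟩
  ⟦ ∂ₜ p *T r ⟧ F +ℚ ⟦ p *T ∂ₜ r ⟧ F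
    ≡⟨ ⟦⟧-++ (∂ₜ p *T r) (p *T ∂ₜ r) F ⟨
  ⟦ ∂ₜ p *T r ++ p *T ∂ₜ r ⟧ F ∎
  where open ≡-Reasoning

∂ₜ-^ : ∀ p n → ∂ₜ (p ^T suc n) ≋ P₃.constant (fromℕ (suc n)) *T ((p ^T n) *T ∂ₜ p)
∂ₜ-^ p zero = begin
  ∂ₜ (p *T 1T)                    ≈⟨ ∂ₜ-leibniz p 1T ⟩
  ∂ₜ p *T 1T ++ p *T ∂ₜ 1T
    ≈⟨ solve 2 (λ d p → d :* con 1ℚ :+ p :* con 0ℚ := con 1ℚ :* (con 1ℚ :* d)) R₃.refl (∂ₜ p) p ⟩
  1T *T (1T *T ∂ₜ p)              ∎
  where
  open P₃.Solver
  open ≈-Reasoning R₃.setoid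
  1T = P₃.constant 1ℚ
∂ₜ-^ p (suc n) = begin
  ∂ₜ (p *T (p ^T suc n))                                  ≈⟨ ∂ₜ-leibniz p (p ^T suc n) ⟩
  ∂ₜ p *T (p ^T suc n) ++ p *T ∂ₜ (p ^T suc n)
    ≈⟨ R₃.+-congˡ {∂ₜ p *T (p ^T suc n)} (R₃.*-congˡ {p} (∂ₜ-^ p n)) ⟩
  ∂ₜ p *T (p ^T suc n) ++ p *T (K *T ((p ^T n) *T ∂ₜ p))
    ≈⟨ solve 4 (λ d p pⁿ k → d :* (p :* pⁿ) :+ p :* (k :* (pⁿ :* d)) := (con 1ℚ :+ k) :* ((p :* pⁿ) :* d))
         R₃.refl (∂ₜ p) p (p ^T n) K ⟩
  (P₃.constant 1ℚ ++ K) *T ((p ^T suc n) *T ∂ₜ p)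
    ≈⟨ R₃.*-congʳ {(p ^T suc n) *T ∂ₜ p} (P₃.constant-+ 1ℚ (fromℕ (suc n))) ⟨
  P₃.constant (fromℕ (suc (suc n))) *T ((p ^T suc n) *T ∂ₜ p) ∎
  where
  open P₃.Solver
  open ≈-Reasoning R₃.setoid
  K = P₃.constant (fromℕ (suc n))

-- σ m k is the monomial m · xᵏ, where x is the variable substituted for t.
module Substitution (σ : Monomial₂ → ℕ → Monomial₂)
                    (σ-zero : ∀ m → σ m 0 ≡ m)
                    (σ-∙ : ∀ m m′ k k′ → σ (m ∙₂ m′) (k + k′) ≡ σ m k ∙₂ σ m′ k′) where

  t≔x : Poly3 → Poly2
  t≔x = linearMap (λ _ → 1ℚ) (λ (k , m) → σ m k)

  ∫₀^x : Poly3 → Poly2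
  ∫₀^x = linearMap (λ (k , _) → + 1 / suc k) (λ (k , m) → σ m (suc k))

  t≔x-* : ∀ p r → t≔x (p *T r) ≋ t≔x p *P t≔x r
  t≔x-* = linearMap-convolve _ (λ (k , m) (k′ , m′) → σ-∙ m m′ k k′)

  t≔x-^ : ∀ p n → t≔x (p ^T n) ≋ t≔x p ^P n
  t≔x-^ p zero    = R₂.reflexive (cong (λ m → (1ℚ , m) ∷ []) (σ-zero (0 , 0)))
  t≔x-^ p (suc n) = R₂.trans (t≔x-* p (p ^T n)) (R₂.*-congˡ {t≔x p} (t≔x-^ p n))

  ∫₀^x-ι* : ∀ s p → ∫₀^x (ι s *T p) ≋ s *P ∫₀^x p
  ∫₀^x-ι* = linearMap-convolveˡ _ _ _ (λ _ _ → refl)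
    (λ b (k , m) → trans (σ-∙ b m 0 (suc k)) (cong (_∙₂ σ m (suc k)) (σ-zero b)))

  ∫₀^x-∂ₜ-monomial : ∀ (F : Monomial₂ → ℚ) k m →
    fromℕ k *ℚ ((+ 1 / suc (k ∸ 1)) *ℚ F (σ m (suc (k ∸ 1)))) +ℚ (if k ℕ.≡ᵇ 0 then 1ℚ else 0ℚ) *ℚ F m
    ≡ 1ℚ *ℚ F (σ m k)
  ∫₀^x-∂ₜ-monomial F zero m rewrite σ-zero m =
    solve 2 (λ x y → con 0ℚ :* x :+ con 1ℚ :* y := con 1ℚ :* y) refl ((+ 1 / 1) *ℚ F (σ m 1)) (F m)
    where open +-*-Solver using (solve; _:=_; _:+_; _:*_; con)
  ∫₀^x-∂ₜ-monomial F (suc k) m = begin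
    fromℕ (suc k) *ℚ ((+ 1 / suc k) *ℚ x) +ℚ 0ℚ *ℚ F m
      ≡⟨ solve 4 (λ c i x y → c :* (i :* x) :+ con 0ℚ :* y := (c :* i) :* x)
           refl (fromℕ (suc k)) (+ 1 / suc k) x (F m) ⟩
    (fromℕ (suc k) *ℚ (+ 1 / suc k)) *ℚ x
      ≡⟨ cong (_*ℚ x) (fromℕ-suc-*-inverse k) ⟩
    1ℚ *ℚ x ∎
    where
    open ≡-Reasoning
    open +-*-Solver using (solve; _:=_; _:+_; _:*_; con)
    x = F (σ m (suc k))

  ∫₀^x-∂ₜ : ∀ p → ∫₀^x (∂ₜ p) ++ t≔0 p ≋ t≔x p
  ∫₀^x-∂ₜ p = mk≋ λ F → begin
    ⟦ ∫₀^x (∂ₜ p) ++ t≔0 p ⟧ F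
      ≡⟨ ⟦⟧-++ (∫₀^x (∂ₜ p)) (t≔0 p) F ⟩
    ⟦ ∫₀^x (∂ₜ p) ⟧ F +ℚ ⟦ t≔0 p ⟧ F
      ≡⟨ cong₂ _+ℚ_ (trans (⟦⟧-linearMap _ _ (∂ₜ p) F) (⟦⟧-linearMap _ _ p _)) (⟦⟧-linearMap _ _ p F) ⟩
    ⟦ p ⟧ _ +ℚ ⟦ p ⟧ _
      ≡⟨ ⟦⟧-linear-+ p _ _ ⟨
    ⟦ p ⟧ _
      ≡⟨ ⟦⟧-congʳ p (λ (k , m) → ∫₀^x-∂ₜ-monomial F k m) ⟩
    ⟦ p ⟧ (λ (k , m) → 1ℚ *ℚ F (σ m k))
      ≡⟨ ⟦⟧-linearMap _ _ p F ⟨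
    ⟦ t≔x p ⟧ F ∎
    where
    open ≡-Reasoning

σ₁ σ₂ : Monomial₂ → ℕ → Monomial₂
σ₁ (i , j) k = (i + k , j)
σ₂ (i , j) k = (i , j + k)

σ₁-identity : ∀ m → σ₁ m 0 ≡ m
σ₁-identity (i , j) = cong (_, j) (ℕ.+-identityʳ i)

σ₂-identity : ∀ m → σ₂ m 0 ≡ m
σ₂-identity (i , j) = cong (i ,_) (ℕ.+-identityʳ j)

σ₁-∙ : ∀ m m′ k k′ → σ₁ (m ∙₂ m′) (k + k′) ≡ σ₁ m k ∙₂ σ₁ m′ k′
σ₁-∙ (i , j) (i′ , j′) k k′ = cong (_, j + j′) (+-interchange i i′ k k′)

σ₂-∙ : ∀ m m′ k k′ → σ₂ (m ∙₂ m′) (k + k′) ≡ σ₂ m k ∙₂ σ₂ m′ k′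
σ₂-∙ (i , j) (i′ , j′) k k′ = cong (i + i′ ,_) (+-interchange j j′ k k′)

module X₁ = Substitution σ₁ σ₁-identity σ₁-∙
module X₂ = Substitution σ₂ σ₂-identity σ₂-∙

-- Divisibility by powers of x₁ - x₂

x₁-x₂ : Poly2
x₁-x₂ = x₁ +P (-P x₂)

-- Δ p = ∫_{x₂}^{x₁} p dt, the component of θ along x₁ - x₂.
Δ : Poly3 → Poly2
Δ p = ∫₀^x₁ p -P ∫₀^x₂ p

Δ-cong : ∀ {p r} → p ≋ r → Δ p ≋ Δ r
Δ-cong p≋r = R₂.+-cong (linearMap-cong _ _ p≋r) (R₂.-‿cong (linearMap-cong _ _ p≋r))

Δ-+ : ∀ p r → Δ (p +T r) ≋ Δ p +P Δ r
Δ-+ p r = begin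
  Δ (p +T r)                                          ≈⟨ R₂.+-cong (R₂.reflexive (linearMap-++ _ _ p r))
                                                           (R₂.-‿cong (R₂.reflexive (linearMap-++ _ _ p r))) ⟩
  (∫₀^x₁ p +P ∫₀^x₁ r) -P (∫₀^x₂ p +P ∫₀^x₂ r)
    ≈⟨ solve 4 (λ a b c d → (a :+ b) :- (c :+ d) := (a :- c) :+ (b :- d))
         R₂.refl (∫₀^x₁ p) (∫₀^x₁ r) (∫₀^x₂ p) (∫₀^x₂ r) ⟩
  Δ p +P Δ r                                          ∎
  where
  open P₂.Solver
  open ≈-Reasoning R₂.setoid

Δ-- : ∀ p r → Δ (p -T r) ≋ Δ p -P Δ r
Δ-- p r = begin
  Δ (p -T r)                                          ≈⟨ Δ-+ p (R₃.- r) ⟩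
  Δ p +P Δ (R₃.- r)                                   ≈⟨ R₂.+-congˡ {Δ p} (R₂.+-cong (linearMap-negate _ _ r)
                                                           (R₂.-‿cong (linearMap-negate _ _ r))) ⟩
  Δ p +P (R₂.- ∫₀^x₁ r -P R₂.- ∫₀^x₂ r)
    ≈⟨ solve 3 (λ d a b → d :+ (:- a :- :- b) := d :- (a :- b)) R₂.refl (Δ p) (∫₀^x₁ r) (∫₀^x₂ r) ⟩
  Δ p -P Δ r                                          ∎
  where
  open P₂.Solver
  open ≈-Reasoning R₂.setoid

Δ-ι* : ∀ s p → Δ (ι s *T p) ≋ s *P Δ p
Δ-ι* s p = begin
  Δ (ι s *T p)                  ≈⟨ R₂.+-cong (X₁.∫₀^x-ι* s p) (R₂.-‿cong (X₂.∫₀^x-ι* s p)) ⟩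
  s *P ∫₀^x₁ p -P s *P ∫₀^x₂ p
    ≈⟨ solve 3 (λ s a b → s :* a :- s :* b := s :* (a :- b)) R₂.refl s (∫₀^x₁ p) (∫₀^x₂ p) ⟩
  s *P Δ p                                            ∎
  where
  open P₂.Solver
  open ≈-Reasoning R₂.setoid

Δ-∂ₜ : ∀ p → Δ (∂ₜ p) ≋ X₁.t≔x p -P X₂.t≔x p
Δ-∂ₜ p = begin
  ∫₀^x₁ (∂ₜ p) -P ∫₀^x₂ (∂ₜ p)
    ≈⟨ solve 3 (λ a b z → a :- b := (a :+ z) :- (b :+ z)) R₂.refl (∫₀^x₁ (∂ₜ p)) (∫₀^x₂ (∂ₜ p)) (t≔0 p) ⟩
  (∫₀^x₁ (∂ₜ p) +P t≔0 p) -P (∫₀^x₂ (∂ₜ p) +P t≔0 p)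
    ≈⟨ R₂.+-cong (X₁.∫₀^x-∂ₜ p) (R₂.-‿cong (X₂.∫₀^x-∂ₜ p)) ⟩
  X₁.t≔x p -P X₂.t≔x p                                          ∎
  where
  open P₂.Solver
  open ≈-Reasoning R₂.setoid

∂ₜ[t-x₂] : ∂ₜ (tT -T x₂T) ≋ P₃.constant 1ℚ
∂ₜ[t-x₂] = mk≋ λ F →
  solve 2 (λ a b → con 1ℚ :* a :+ (con 0ℚ :* b :+ con 0ℚ) := con 1ℚ :* a :+ con 0ℚ)
    refl (F (0 , 0 , 0)) (F (0 , 0 , 1))
  where open +-*-Solver using (solve; _:=_; _:+_; _:*_; con)

t≔x₂[t-x₂] : X₂.t≔x (tT -T x₂T) ≋ []
t≔x₂[t-x₂] = mk≋ λ F → solve 1 (λ a → con 1ℚ :* a :+ (con (-ℚ 1ℚ) :* a :+ con 0ℚ) := con 0ℚ) refl (F (0 , 1))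
  where open +-*-Solver using (solve; _:=_; _:+_; _:*_; con)

∂ₜ[t-x₂]^suc : ∀ n → ∂ₜ ((tT -T x₂T) ^T suc n) ≋ ι (P₂.constant (fromℕ (suc n))) *T ((tT -T x₂T) ^T n)
∂ₜ[t-x₂]^suc n = begin
  ∂ₜ ((tT -T x₂T) ^T suc n)                                   ≈⟨ ∂ₜ-^ (tT -T x₂T) n ⟩
  P₃.constant (fromℕ (suc n)) *T (((tT -T x₂T) ^T n) *T ∂ₜ (tT -T x₂T))
    ≈⟨ R₃.*-congˡ {P₃.constant (fromℕ (suc n))} (R₃.*-congˡ {(tT -T x₂T) ^T n} ∂ₜ[t-x₂]) ⟩
  P₃.constant (fromℕ (suc n)) *T (((tT -T x₂T) ^T n) *T P₃.constant 1ℚ)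
    ≈⟨ R₃.*-cong (R₃.sym (ι-constant (fromℕ (suc n)))) (R₃.*-identityʳ _) ⟩
  ι (P₂.constant (fromℕ (suc n))) *T ((tT -T x₂T) ^T n)      ∎
  where open ≈-Reasoning R₃.setoid

Δ[t-x₂]^ : ∀ n → P₂.constant (fromℕ (suc n)) *P Δ ((tT -T x₂T) ^T n) ≋ x₁-x₂ ^P suc n
Δ[t-x₂]^ n = begin
  K *P Δ (f n)                                      ≈⟨ Δ-ι* K (f n) ⟨
  Δ (ι K *T f n)                                    ≈⟨ Δ-cong (∂ₜ[t-x₂]^suc n) ⟨
  Δ (∂ₜ (f (suc n)))                                ≈⟨ Δ-∂ₜ (f (suc n)) ⟩
  X₁.t≔x (f (suc n)) -P X₂.t≔x (f (suc n))
    ≈⟨ R₂.+-cong (X₁.t≔x-^ (tT -T x₂T) (suc n)) (R₂.-‿cong (X₂.t≔x-^ (tT -T x₂T) (suc n))) ⟩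
  x₁-x₂ ^P suc n -P (X₂.t≔x (tT -T x₂T) ^P suc n)
    ≈⟨ R₂.+-congˡ {x₁-x₂ ^P suc n} (R₂.-‿cong (R₂.trans (R₂.*-congʳ {X₂.t≔x (tT -T x₂T) ^P n} t≔x₂[t-x₂])
                                                       (R₂.zeroˡ (X₂.t≔x (tT -T x₂T) ^P n)))) ⟩
  x₁-x₂ ^P suc n -P []                              ≈⟨ R₂.+-identityʳ (x₁-x₂ ^P suc n) ⟩
  x₁-x₂ ^P suc n                                    ∎
  where
  open ≈-Reasoning R₂.setoid
  f = (tT -T x₂T) ^T_
  K = P₂.constant (fromℕ (suc n))

x₁-x₂^-∣-Δ[t-x₂]^ : ∀ n → x₁-x₂ ^P suc n ∣ Δ ((tT -T x₂T) ^T n)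
x₁-x₂^-∣-Δ[t-x₂]^ n = c , (begin
  c *P (x₁-x₂ ^P suc n)                   ≈⟨ R₂.*-congˡ {c} (R₂.sym (Δ[t-x₂]^ n)) ⟩
  c *P (K *P Δ f)                         ≈⟨ R₂.sym (R₂.*-assoc c K (Δ f)) ⟩
  (c *P K) *P Δ f                         ≈⟨ R₂.*-congʳ {Δ f} (R₂.sym (P₂.constant-* c′ (fromℕ (suc n)))) ⟩
  P₂.constant (c′ *ℚ fromℕ (suc n)) *P Δ f ≈⟨ R₂.*-congʳ {Δ f} (R₂.reflexive (cong P₂.constant c′*K≡1)) ⟩
  P₂.constant 1ℚ *P Δ f                   ≈⟨ R₂.*-identityˡ (Δ f) ⟩
  Δ f                                     ∎)
  where
  open ≈-Reasoning R₂.setoid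
  f = (tT -T x₂T) ^T n
  c′ = + 1 / suc n
  c = P₂.constant c′
  K = P₂.constant (fromℕ (suc n))
  c′*K≡1 : c′ *ℚ fromℕ (suc n) ≡ 1ℚ
  c′*K≡1 = trans (ℚ.*-comm c′ (fromℕ (suc n))) (fromℕ-suc-*-inverse n)

integrand-sucᵇ : ∀ a b c → integrand a (suc b) c ≋ integrand (suc a) b c -T (ι x₁-x₂ *T integrand a b c)
integrand-sucᵇ a b c =
  solve 6 (λ t x y T B A →
            (T :* ((t :- x) :* B)) :* A := (T :* B) :* ((t :- y) :* A) :- (x :- y) :* ((T :* B) :* A))
    R₃.refl tT x₁T x₂T (tT ^T c) ((tT -T x₁T) ^T b) ((tT -T x₂T) ^T a)
  where open P₃.Solver

integrand-sucᶜ : ∀ a b c → integrand a b (suc c) ≋ integrand (suc a) b c +T (ι x₂ *T integrand a b c)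
integrand-sucᶜ a b c =
  solve 5 (λ t y T B A → ((t :* T) :* B) :* A := (T :* B) :* ((t :- y) :* A) :+ y :* ((T :* B) :* A))
    R₃.refl tT x₂T (tT ^T c) ((tT -T x₁T) ^T b) ((tT -T x₂T) ^T a)
  where open P₃.Solver

Δ-integrand-sucᵇ : ∀ a b c →
  Δ (integrand a (suc b) c) ≋ Δ (integrand (suc a) b c) -P x₁-x₂ *P Δ (integrand a b c)
Δ-integrand-sucᵇ a b c = begin
  Δ (integrand a (suc b) c)                                      ≈⟨ Δ-cong (integrand-sucᵇ a b c) ⟩
  Δ (integrand (suc a) b c -T (ι x₁-x₂ *T integrand a b c))
    ≈⟨ Δ-- (integrand (suc a) b c) (ι x₁-x₂ *T integrand a b c) ⟩
  Δ (integrand (suc a) b c) -P Δ (ι x₁-x₂ *T integrand a b c)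
    ≈⟨ R₂.+-congˡ {Δ (integrand (suc a) b c)} (R₂.-‿cong (Δ-ι* x₁-x₂ (integrand a b c))) ⟩
  Δ (integrand (suc a) b c) -P x₁-x₂ *P Δ (integrand a b c)      ∎
  where open ≈-Reasoning R₂.setoid

Δ-integrand-sucᶜ : ∀ a b c →
  Δ (integrand a b (suc c)) ≋ Δ (integrand (suc a) b c) +P (x₂ *P Δ (integrand a b c))
Δ-integrand-sucᶜ a b c = begin
  Δ (integrand a b (suc c))                                      ≈⟨ Δ-cong (integrand-sucᶜ a b c) ⟩
  Δ (integrand (suc a) b c +T (ι x₂ *T integrand a b c))
    ≈⟨ Δ-+ (integrand (suc a) b c) (ι x₂ *T integrand a b c) ⟩
  Δ (integrand (suc a) b c) +P Δ (ι x₂ *T integrand a b c)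
    ≈⟨ R₂.+-congˡ {Δ (integrand (suc a) b c)} (Δ-ι* x₂ (integrand a b c)) ⟩
  Δ (integrand (suc a) b c) +P (x₂ *P Δ (integrand a b c))       ∎
  where open ≈-Reasoning R₂.setoid

x₁-x₂^-∣-Δ-integrand : ∀ a b c → x₁-x₂ ^P suc (a + b) ∣ Δ (integrand a b c)
x₁-x₂^-∣-Δ-integrand a zero zero =
  subst (λ n → x₁-x₂ ^P suc n ∣ Δ (integrand a 0 0)) (sym (ℕ.+-identityʳ a))
    (∣ʳ-respʳ-≈ (Δ-cong (R₃.sym integrand-base)) (x₁-x₂^-∣-Δ[t-x₂]^ a))
  where
  integrand-base : integrand a 0 0 ≋ (tT -T x₂T) ^T a
  integrand-base = solve 1 (λ A → (con 1ℚ :* con 1ℚ) :* A := A) R₃.refl ((tT -T x₂T) ^T a)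
    where open P₃.Solver
x₁-x₂^-∣-Δ-integrand a zero (suc c) =
  ∣ʳ-respʳ-≈ (R₂.sym (Δ-integrand-sucᶜ a 0 c))
    (x∣y∧x∣z⇒x∣y+z P₂.ring (∣ʳ-trans (x∣ʳyx (x₁-x₂ ^P suc (a + 0)) x₁-x₂) (x₁-x₂^-∣-Δ-integrand (suc a) 0 c))
                           (x∣ʳy⇒x∣ʳzy x₂ (x₁-x₂^-∣-Δ-integrand a 0 c)))
x₁-x₂^-∣-Δ-integrand a (suc b) c =
  subst (λ n → x₁-x₂ ^P suc n ∣ Δ (integrand a (suc b) c)) (sym (ℕ.+-suc a b))
    (∣ʳ-respʳ-≈ (R₂.sym (Δ-integrand-sucᵇ a b c))
      (x∣y∧x∣z⇒x∣y-z P₂.ring (x₁-x₂^-∣-Δ-integrand (suc a) b c) (x∣y⇒zx∣zy x₁-x₂ (x₁-x₂^-∣-Δ-integrand a b c))))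

-- Degrees and orders of monomials

module Grading (D : ℕ → Monomial₃ → Set) (D-ε : D 0 (0 , 0 , 0))
               (D-∙ : ∀ {m n} a b → D m a → D n b → D (m + n) (a ∙₃ b)) where

  Graded : ℕ → Poly3 → Set
  Graded n = All (D n ∘ proj₂)

  graded-* : ∀ {m n p r} → Graded m p → Graded n r → Graded (m + n) (p *T r)
  graded-* = All-convolve (λ {a} {b} → D-∙ a b)

  graded-^ : ∀ {p} → Graded 1 p → ∀ n → Graded n (p ^T n)
  graded-^ G zero    = D-ε ∷ []
  graded-^ G (suc n) = graded-* G (graded-^ G n)

Degree Order₁ Order₂ : ℕ → Monomial₃ → Set
Degree n (k , i , j) = k + i + j ≡ n
Order₁ n (k , i , _) = n ≤ k + i
Order₂ n (k , _ , j) = n ≤ k + j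

Degree-∙ : ∀ {m n} a b → Degree m a → Degree n b → Degree (m + n) (a ∙₃ b)
Degree-∙ (k , i , j) (k′ , i′ , j′) d d′ =
  trans (trans (cong (_+ (j + j′)) (+-interchange k k′ i i′)) (+-interchange (k + i) (k′ + i′) j j′))
        (cong₂ _+_ d d′)

Order₁-∙ : ∀ {m n} a b → Order₁ m a → Order₁ n b → Order₁ (m + n) (a ∙₃ b)
Order₁-∙ {m} {n} (k , i , _) (k′ , i′ , _) o o′ =
  subst (m + n ≤_) (sym (+-interchange k k′ i i′)) (ℕ.+-mono-≤ o o′)

Order₂-∙ : ∀ {m n} a b → Order₂ m a → Order₂ n b → Order₂ (m + n) (a ∙₃ b)
Order₂-∙ {m} {n} (k , _ , j) (k′ , _ , j′) o o′ =
  subst (m + n ≤_) (sym (+-interchange k k′ j j′)) (ℕ.+-mono-≤ o o′)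

module ByDegree = Grading Degree refl Degree-∙
module ByOrder₁ = Grading Order₁ z≤n Order₁-∙
module ByOrder₂ = Grading Order₂ z≤n Order₂-∙

integrand-degree : ∀ a b c → ByDegree.Graded (c + b + a) (integrand a b c)
integrand-degree a b c =
  graded-* (graded-* (graded-^ (refl ∷ []) c) (graded-^ (refl ∷ refl ∷ []) b)) (graded-^ (refl ∷ refl ∷ []) a)
  where open ByDegree

integrand-order₁ : ∀ a b c → ByOrder₁.Graded (c + b + 0) (integrand a b c)
integrand-order₁ a b c =
  graded-* (graded-* (graded-^ (s≤s z≤n ∷ []) c) (graded-^ (s≤s z≤n ∷ s≤s z≤n ∷ []) b))
           (All.universal (λ _ → z≤n) _)
  where open ByOrder₁

integrand-order₂ : ∀ a b c → ByOrder₂.Graded (c + 0 + a) (integrand a b c)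
integrand-order₂ a b c =
  graded-* (graded-* (graded-^ (s≤s z≤n ∷ []) c) (All.universal (λ _ → z≤n) _))
           (graded-^ (s≤s z≤n ∷ s≤s z≤n ∷ []) a)
  where open ByOrder₂

θ-homogeneous : ∀ a b c → HomogeneousVF (suc (a + b + c)) (θ a b c)
θ-homogeneous a b c =
    All⇒HomogeneousPoly _ _
      (All-linearMap (λ {(k , i , j)} d → trans (shift₁ k i j) (cong suc (trans d (reorder a b c)))) degrees)
  , All⇒HomogeneousPoly _ _
      (All-linearMap (λ {(k , i , j)} d → trans (shift₂ k i j) (cong suc (trans d (reorder a b c)))) degrees)
  where
  degrees = integrand-degree a b c
  shift₁ : ∀ k i j → i + suc k + j ≡ suc (k + i + j)
  shift₁ = ℕ-solve-∀
  shift₂ : ∀ k i j → i + (j + suc k) ≡ suc (k + i + j)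
  shift₂ = ℕ-solve-∀
  reorder : ∀ a b c → c + b + a ≡ a + b + c
  reorder = ℕ-solve-∀

-- Divisibility by powers of x₁ and x₂

^P-cong : ∀ {p r} n → p ≋ r → p ^P n ≋ r ^P n
^P-cong zero    p≋r = R₂.refl
^P-cong (suc n) p≋r = R₂.*-cong p≋r (^P-cong n p≋r)

x₁^-monomial : ∀ N → x₁ ^P N ≋ P₂.monomial (N , 0)
x₁^-monomial zero    = R₂.refl
x₁^-monomial (suc N) = R₂.*-congˡ {x₁} (x₁^-monomial N)

x₂^-monomial : ∀ N → x₂ ^P N ≋ P₂.monomial (0 , N)
x₂^-monomial zero    = R₂.refl
x₂^-monomial (suc N) = R₂.*-congˡ {x₂} (x₂^-monomial N)

linPoly-x₁ : linPoly (1ℚ , 0ℚ) ≋ x₁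
linPoly-x₁ = mk≋ λ F →
  solve 2 (λ u v → con 1ℚ :* u :+ (con 0ℚ :* v :+ con 0ℚ) := con 1ℚ :* u :+ con 0ℚ) refl (F (1 , 0)) (F (0 , 1))
  where open +-*-Solver using (solve; _:=_; _:+_; _:*_; con)

linPoly-x₂ : linPoly (0ℚ , 1ℚ) ≋ x₂
linPoly-x₂ = mk≋ λ F →
  solve 2 (λ u v → con 0ℚ :* u :+ (con 1ℚ :* v :+ con 0ℚ) := con 1ℚ :* v :+ con 0ℚ) refl (F (1 , 0)) (F (0 , 1))
  where open +-*-Solver using (solve; _:=_; _:+_; _:*_; con)

x₁^-∣ : ∀ N g → All (λ (_ , (i , _)) → N ≤ i) g → linPoly (1ℚ , 0ℚ) ^P N ∣ g
x₁^-∣ N g N≤ = h , R₂.sym (begin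
  g
    ≈⟨ P₂.factor-monomial (N , 0) d g (All.map (λ N≤i → cong (_, _) (ℕ.m+[n∸m]≡n N≤i)) N≤) ⟩
  P₂.monomial (N , 0) *P h      ≈⟨ R₂.*-comm _ h ⟩
  h *P P₂.monomial (N , 0)      ≈⟨ R₂.*-congˡ {h} (R₂.sym (R₂.trans (^P-cong N linPoly-x₁) (x₁^-monomial N))) ⟩
  h *P (linPoly (1ℚ , 0ℚ) ^P N) ∎)
  where
  open ≈-Reasoning R₂.setoid
  d = λ (i , j) → (i ∸ N , j)
  h = linearMap (λ _ → 1ℚ) d g

x₂^-∣ : ∀ N g → All (λ (_ , (_ , j)) → N ≤ j) g → linPoly (0ℚ , 1ℚ) ^P N ∣ g
x₂^-∣ N g N≤ = h , R₂.sym (begin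
  g
    ≈⟨ P₂.factor-monomial (0 , N) d g (All.map (λ N≤j → cong (_ ,_) (ℕ.m+[n∸m]≡n N≤j)) N≤) ⟩
  P₂.monomial (0 , N) *P h      ≈⟨ R₂.*-comm _ h ⟩
  h *P P₂.monomial (0 , N)      ≈⟨ R₂.*-congˡ {h} (R₂.sym (R₂.trans (^P-cong N linPoly-x₂) (x₂^-monomial N))) ⟩
  h *P (linPoly (0ℚ , 1ℚ) ^P N) ∎)
  where
  open ≈-Reasoning R₂.setoid
  d = λ (i , j) → (i , j ∸ N)
  h = linearMap (λ _ → 1ℚ) d g

∣⇒∣P : ∀ {f g} → f ∣ g → f ∣P g
∣⇒∣P {f} (q , q*f≋g) = q , ≋⇒≈P (R₂.trans (R₂.sym q*f≋g) (R₂.*-comm q f))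

x₁^-∣-θ[x₁] : ∀ a b c → linPoly (1ℚ , 0ℚ) ^P suc (b + c) ∣ applyVF (θ a b c) (1ℚ , 0ℚ)
x₁^-∣-θ[x₁] a b c = ∣ʳ-respʳ-≈ (R₂.sym θ[x₁]≋θ₁)
  (x₁^-∣ _ _ (All-linearMap (λ {(k , i , _)} o → subst₂ _≤_ (cong suc (reorder b c)) (shift k i) (s≤s o))
                            (integrand-order₁ a b c)))
  where
  θ[x₁]≋θ₁ : applyVF (θ a b c) (1ℚ , 0ℚ) ≋ ∫₀^x₁ (integrand a b c)
  θ[x₁]≋θ₁ = solve 2 (λ u v → con 1ℚ :* u :+ con 0ℚ :* v := u) R₂.refl
               (∫₀^x₁ (integrand a b c)) (∫₀^x₂ (integrand a b c))
    where open P₂.Solver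
  reorder : ∀ b c → c + b + 0 ≡ b + c
  reorder = ℕ-solve-∀
  shift : ∀ k i → suc (k + i) ≡ i + suc k
  shift = ℕ-solve-∀

x₂^-∣-θ[x₂] : ∀ a b c → linPoly (0ℚ , 1ℚ) ^P suc (a + c) ∣ applyVF (θ a b c) (0ℚ , 1ℚ)
x₂^-∣-θ[x₂] a b c = ∣ʳ-respʳ-≈ (R₂.sym θ[x₂]≋θ₂)
  (x₂^-∣ _ _ (All-linearMap (λ {(k , _ , j)} o → subst₂ _≤_ (cong suc (reorder a c)) (shift k j) (s≤s o))
                            (integrand-order₂ a b c)))
  where
  θ[x₂]≋θ₂ : applyVF (θ a b c) (0ℚ , 1ℚ) ≋ ∫₀^x₂ (integrand a b c)
  θ[x₂]≋θ₂ = solve 2 (λ u v → con 0ℚ :* u :+ con 1ℚ :* v := v) R₂.refl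
               (∫₀^x₁ (integrand a b c)) (∫₀^x₂ (integrand a b c))
    where open P₂.Solver
  reorder : ∀ a c → c + 0 + a ≡ a + c
  reorder = ℕ-solve-∀
  shift : ∀ k j → suc (k + j) ≡ j + suc k
  shift = ℕ-solve-∀

x₁-x₂^-∣-θ[x₁-x₂] : ∀ a b c → linPoly (1ℚ , -ℚ 1ℚ) ^P suc (a + b) ∣ applyVF (θ a b c) (1ℚ , -ℚ 1ℚ)
x₁-x₂^-∣-θ[x₁-x₂] a b c = ∣ʳ-respʳ-≈ (R₂.sym θ[x₁-x₂]≋Δ) (x₁-x₂^-∣-Δ-integrand a b c)
  where
  θ[x₁-x₂]≋Δ : applyVF (θ a b c) (1ℚ , -ℚ 1ℚ) ≋ Δ (integrand a b c)
  θ[x₁-x₂]≋Δ = solve 2 (λ u v → con 1ℚ :* u :+ con (-ℚ 1ℚ) :* v := u :- v) R₂.refl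
                 (∫₀^x₁ (integrand a b c)) (∫₀^x₂ (integrand a b c))
    where open P₂.Solver

proposition2p2 : (a b c : ℕ) →
    HomogeneousVF (suc (a + b + c)) (θ a b c) × (θ a b c ∈D 𝒜 a b c)
proposition2p2 a b c =
    θ-homogeneous a b c
  , ∣⇒∣P (x₁^-∣-θ[x₁] a b c) ∷ ∣⇒∣P (x₂^-∣-θ[x₂] a b c) ∷ ∣⇒∣P (x₁-x₂^-∣-θ[x₁-x₂] a b c) ∷ []
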